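{- If a relation $\gamma:Z\rightharpoonup\wp(W)$ is union-closed, then for every relation $\rho:Z\rightharpoonup\wp(W)$ with $\rho\sqsubseteq\gamma$ there exists a partial function $g:Z\rightharpoonup\wp(W)$ such that $g\sqsubseteq_c\gamma$ and $\mathrm{dom}\,\rho\;g\ni_W=\rho\ni_W$.
   Context: Relations $\alpha:X\rightharpoonup Y$ are subsets of $X\times Y$ (sets with the axiom of choice); juxtaposition is relational composition; $\sqsubseteq$ inclusion; $\mathrm{dom}\,\alpha=\{(x,x)\mid\exists y.\,(x,y)\in\alpha\}$; a pfn (partial function) is a univalent relation. $\ni_W:\wp(W)\rightharpoonup W$ is membership, $(A,w)\in\ni_W$ iff $w\in A$. For $\rho:Z\rightharpoonup W$, $\rho^@:Z\to\wp(W)$ is $z\mapsto\{w\mid(z,w)\in\rho\}$. $g\sqsubseteq_c\gamma$ means $g\sqsubseteq\gamma$, $g$ a pfn, $\mathrm{dom}\,g=\mathrm{dom}\,\gamma$. A relation $\gamma:Z\rightharpoonup\wp(W)$ is union-closed if $\mathrm{dom}\,\rho\,(\rho\ni_W)^@\sqsubseteq\gamma$ for all relations $\rho\sqsubseteq\gamma$; equivalently, for each $a\in Z$, every nonempty family $\mathcal B\subseteq\{B\mid(a,B)\in\gamma\}$ satisfies $(a,\bigcup\mathcal B)\in\gamma$. -}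

module Defs where

open import Level using (Level; _⊔_) renaming (suc to lsuc)
open import Data.Product using (Σ; ∃; _×_; _,_)
open import Relation.Binary.Core using (REL)
open import Relation.Binary.PropositionalEquality using (_≡_)
open import Relation.Unary using (_≐_)

private
  variable
    a b c ℓ r r' : Level
    A B C : Set a

℘ : Set ℓ → Set (lsuc ℓ)
℘ {ℓ} W = W → Set ℓ

∋ : (W : Set ℓ) → REL (℘ W) W ℓ
∋ W S w = S w

-- Relational composition (diagrammatic order, juxtaposition in the paper).
infixr 9 _⨾_
_⨾_ : ∀ {r r'} → REL A B r → REL B C r' → REL A C _
_⨾_ {B = B} α β x z = ∃ λ (y : B) → α x y × β y z

infix 4 _⊑_ _≋_
_⊑_ : ∀ {r r'} → REL A B r → REL A B r' → Set _
α ⊑ β = ∀ {x y} → α x y → β x y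

_≋_ : ∀ {r r'} → REL A B r → REL A B r' → Set _
α ≋ β = (α ⊑ β) × (β ⊑ α)

dom : ∀ {r} → REL A B r → REL A A _
dom {B = B} α x x' = x ≡ x' × ∃ λ (y : B) → α x y

IsPfn : ∀ {W : Set ℓ} → REL A (℘ W) r → Set _
IsPfn g = ∀ {x S T} → g x S → g x T → S ≐ T

_⊑c_ : ∀ {W : Set ℓ} → REL A (℘ W) r → REL A (℘ W) r' → Set _
g ⊑c γ = (g ⊑ γ) × IsPfn g × (dom g ≋ dom γ)

-- Union-closed:  dom ρ (ρ ∋_W)^@ ⊑ γ  for all relations ρ ⊑ γ.
-- Since (ρ ∋_W)^@ z = {w | (z , w) ∈ ρ ∋_W} is not in the small universe
-- ℘ W predicatively, "(z , (ρ∋)^@ z) ∈ γ" is rendered as: γ relates z to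
-- some subset U which (extensionally) equals {w | (z , w) ∈ ρ ∋_W}.
UnionClosed : ∀ {a ℓ r} {A : Set a} {W : Set ℓ} → REL A (℘ W) r → Set _
UnionClosed {a} {ℓ} {r} {A} {W} γ =
  (ρ : REL A (℘ W) r) → ρ ⊑ γ →
  ∀ {z z'} → dom ρ z z' →
  ∃ λ (U : ℘ W) → γ z U × (U ≐ (ρ ⨾ ∋ W) z)

-- For σ ⊑ γ, union-closedness puts (z , ⋃{B | σ z B}) into γ for every
-- z ∈ dom σ, and the union is determined by z, so these pairs form a pfn
-- below γ with domain dom σ.  Use σ = ρ on dom ρ and, by excluded middle,
-- σ = γ off dom ρ: the glued pfn has domain dom γ and, on dom ρ, its members
-- are exactly those of the sets ρ relates to.
module Submission where

open import Defs
open import Level using (Level; _⊔_) renaming (suc to lsuc)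
open import Data.Product using (∃; _×_; _,_)
open import Data.Sum using (inj₁; inj₂)
open import Relation.Nullary using (¬_; yes; no; contradiction)
open import Relation.Binary.Core using (REL)
open import Relation.Binary.Construct.Union using (_∪_)
open import Relation.Binary.PropositionalEquality using (_≡_; refl)
open import Relation.Unary using (_≐_)
open import Relation.Unary.Properties using (≐-sym; ≐-trans)
open import Axiom.ExcludedMiddle using (ExcludedMiddle)
open import Function using (id)

private
  variable
    a b c d ℓ p q r s : Level
    A : Set a
    B : Set b
    C : Set c
    D : Set d
    W : Set ℓ

≋-trans : {α : REL A B p} {β : REL A B q} {δ : REL A B r} → α ≋ β → β ≋ δ → α ≋ δ
≋-trans (α⊑β , β⊑α) (β⊑δ , δ⊑β) = (λ x → β⊑δ (α⊑β x)) , (λ x → β⊑α (δ⊑β x))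

⨾-congˡ : {α : REL A B p} {β : REL B C q} {β′ : REL B C r} → β ≋ β′ → (α ⨾ β) ≋ (α ⨾ β′)
⨾-congˡ (β⊑β′ , β′⊑β) = (λ { (y , αxy , βyz) → y , αxy , β⊑β′ βyz })
                       , (λ { (y , αxy , β′yz) → y , αxy , β′⊑β β′yz })

dom-⊑ : {α : REL A B p} {β : REL A B q} → α ⊑ β → dom α ⊑ dom β
dom-⊑ α⊑β (x≡x′ , y , αxy) = x≡x′ , y , α⊑β αxy

dom-⨾ : {α : REL A B p} {β : REL B C q} → (dom α ⨾ α ⨾ β) ≋ (α ⨾ β)
dom-⨾ = (λ { (_ , (refl , _) , αβxz) → αβxz })
      , (λ { αβxz@(y , αxy , _) → _ , (refl , y , αxy) , αβxz })

∁dom : REL A B p → REL A A _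
∁dom {B = B} α x x′ = x ≡ x′ × ¬ ∃ λ (y : B) → α x y

unionGraph : REL A (℘ W) r → REL A (℘ W) s → REL A (℘ W) _
unionGraph {W = W} γ σ z U = γ z U × (U ≐ (σ ⨾ ∋ W) z)

module _ (γ : REL A (℘ W) r) (σ : REL A (℘ W) s) where

  unionGraph-⊑ : unionGraph γ σ ⊑ γ
  unionGraph-⊑ (γzU , _) = γzU

  unionGraph-isPfn : IsPfn (unionGraph γ σ)
  unionGraph-isPfn (_ , S≐⋃) (_ , T≐⋃) = ≐-trans S≐⋃ (≐-sym T≐⋃)

unionGraph-dom : {γ : REL A (℘ W) r} → UnionClosed γ
               → (σ : REL A (℘ W) r) → σ ⊑ γ
               → dom σ ⊑ dom (unionGraph γ σ)
unionGraph-dom uc σ σ⊑γ d@(refl , _) with uc σ σ⊑γ d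
... | U , γzU , U≐⋃ = refl , U , γzU , U≐⋃

unionGraph-⨾∋ : {γ : REL A (℘ W) r} → UnionClosed γ
              → (σ : REL A (℘ W) r) → σ ⊑ γ
              → (unionGraph γ σ ⨾ ∋ W) ≋ (σ ⨾ ∋ W)
unionGraph-⨾∋ uc σ σ⊑γ = (λ { (_ , (_ , (U⊆⋃ , _)) , w∈U) → U⊆⋃ w∈U }) , ⋃⊆unionGraph
  where
  ⋃⊆unionGraph : (σ ⨾ ∋ _) ⊑ (unionGraph _ σ ⨾ ∋ _)
  ⋃⊆unionGraph w∈⋃@(B , σzB , _) with unionGraph-dom uc σ σ⊑γ (refl , B , σzB)
  ... | _ , U , ugzU@(_ , (_ , ⋃⊆U)) = U , ugzU , ⋃⊆U w∈⋃

glue : REL A B p → REL A C q → REL A C s → REL A C _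
glue α f h = (dom α ⨾ f) ∪ (∁dom α ⨾ h)

module _ {α : REL A B p} {f : REL A C q} {h : REL A C s} where

  glue-⊑ : {γ : REL A C r} → f ⊑ γ → h ⊑ γ → glue α f h ⊑ γ
  glue-⊑ f⊑γ h⊑γ (inj₁ (_ , (refl , _) , fxy)) = f⊑γ fxy
  glue-⊑ f⊑γ h⊑γ (inj₂ (_ , (refl , _) , hxy)) = h⊑γ hxy

  dom-⨾-glue : {R : REL C D r} → (dom α ⨾ glue α f h ⨾ R) ≋ (dom α ⨾ f ⨾ R)
  dom-⨾-glue = (λ { (_ , dα , y , inj₁ (_ , (refl , _) , fxy) , Ryz) → _ , dα , y , fxy , Ryz
                  ; (_ , (refl , αx) , _ , inj₂ (_ , (refl , ¬αx) , _) , _) → contradiction αx ¬αx })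
             , (λ { (_ , dα@(refl , _) , y , fxy , Ryz) → _ , dα , y , inj₁ (_ , dα , fxy) , Ryz })

glue-dom : {A : Set a} {B : Set b} {α : REL A B p} {f : REL A C q} {h : REL A C s} {δ : REL A D r}
         → ExcludedMiddle (a ⊔ b ⊔ p)
         → dom α ⊑ dom f → dom δ ⊑ dom h → dom δ ⊑ dom (glue α f h)
glue-dom {α = α} em dα⊑df dδ⊑dh {x = x} dδ@(refl , _) with em {dom α x x}
... | yes dα with dα⊑df dα
...   | _ , y , fxy = refl , y , inj₁ (x , dα , fxy)
glue-dom em dα⊑df dδ⊑dh {x = x} dδ | no ¬dα with dδ⊑dh dδ
...   | _ , y , hxy = refl , y , inj₂ (x , (refl , λ αx → ¬dα (refl , αx)) , hxy)

glue-isPfn : {α : REL A B p} {f : REL A (℘ W) q} {h : REL A (℘ W) s}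
           → IsPfn f → IsPfn h → IsPfn (glue α f h)
glue-isPfn f-pfn h-pfn (inj₁ (_ , (refl , _) , fxS)) (inj₁ (_ , (refl , _) , fxT)) = f-pfn fxS fxT
glue-isPfn f-pfn h-pfn (inj₂ (_ , (refl , _) , hxS)) (inj₂ (_ , (refl , _) , hxT)) = h-pfn hxS hxT
glue-isPfn f-pfn h-pfn (inj₁ (_ , (refl , αx) , _)) (inj₂ (_ , (refl , ¬αx) , _)) = contradiction αx ¬αx
glue-isPfn f-pfn h-pfn (inj₂ (_ , (refl , ¬αx) , _)) (inj₁ (_ , (refl , αx) , _)) = contradiction αx ¬αx

proposition8p1 : ∀ {a ℓ r} {Z : Set a} {W : Set ℓ}
    → ExcludedMiddle (a ⊔ lsuc ℓ ⊔ r)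
    → (γ : REL Z (℘ W) r) → UnionClosed γ
    → (ρ : REL Z (℘ W) r) → ρ ⊑ γ
    → ∃ λ (g : REL Z (℘ W) (a ⊔ lsuc ℓ ⊔ r))
    → (g ⊑c γ) × ((dom ρ ⨾ g ⨾ ∋ W) ≋ (ρ ⨾ ∋ W))
proposition8p1 em γ uc ρ ρ⊑γ = g , (g⊑γ , g-isPfn , dom-⊑ {α = g} g⊑γ , dom-γ⊑dom-g) , agrees
  where
  g : REL _ (℘ _) _
  g = glue ρ (unionGraph γ ρ) (unionGraph γ γ)

  g⊑γ : g ⊑ γ
  g⊑γ = glue-⊑ {α = ρ} {f = unionGraph γ ρ} {h = unionGraph γ γ}
               (unionGraph-⊑ γ ρ) (unionGraph-⊑ γ γ)

  g-isPfn : IsPfn g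
  g-isPfn = glue-isPfn {α = ρ} (unionGraph-isPfn γ ρ) (unionGraph-isPfn γ γ)

  dom-γ⊑dom-g : dom γ ⊑ dom g
  dom-γ⊑dom-g = glue-dom em (unionGraph-dom uc ρ ρ⊑γ) (unionGraph-dom uc γ id)

  agrees : (dom ρ ⨾ g ⨾ ∋ _) ≋ (ρ ⨾ ∋ _)
  agrees = ≋-trans (dom-⨾-glue {α = ρ})
             (≋-trans (⨾-congˡ (unionGraph-⨾∋ uc ρ ρ⊑γ)) (dom-⨾ {α = ρ}))
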